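{- Let $d\geq 1$ and $n\ge 2$. Let $T^d$ be a $d$-hypertree on $[n-1]$ and $T^{d-1}$ a $(d-1)$-hypertree on $[n-1]$, and let $T_n^d = T^d \oplus \mathrm{Cone}_n(T^{d-1})$ (a $d$-hypertree on $[n]$). For any $(d-1)$-cycle $Z$ on $[n]$, \[\mathrm{Fill}(Z,T_n^d) = \mathrm{Cone}_n(F) \oplus \mathrm{Fill}(Z', T^d),\] where $F = \mathrm{Fill}(\mathrm{Link}_n(Z), T^{d-1})$ and $Z' = Z \oplus \mathrm{Cone}_n(\mathrm{Link}_n(Z)) \oplus F$.
   Context: All chains are over $\mathbb{F}_2$ and identified with their supports (sets of simplices); $\oplus$ is symmetric difference. A $k$-simplex is a $(k+1)$-element set of vertices. The boundary $\partial X$ of a set $X$ of $k$-simplices is the set of $(k-1)$-simplices contained in an odd number of members of $X$. A $k$-cycle is a set $Z$ with $\partial Z=\emptyset$. A $k$-forest is a set of $k$-simplices no nonempty subset of which is a $k$-cycle; a $k$-hypertree on a vertex set $V$ is an inclusion-maximal $k$-forest among all $k$-simplices on $V$. For a $k$-hypertree $T$ on $V$ and a $(k-1)$-cycle $Z$ on $V$, $\mathrm{Fill}(Z,T)$ denotes the unique subset $F\subseteq T$ with $\partial F = Z$ (for $k=0$ conventions aside). For a set $Y$ of $k$-simplices and a vertex $v$ not in any of them, $\mathrm{Cone}_v(Y)=\{\sigma\cup\{v\}:\sigma\in Y\}$. For a set $X$ of $k$-simplices and a vertex $v$, $\mathrm{Link}_v(X)=\{\sigma\setminus\{v\}: \sigma\in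 X, v\in\sigma\}$ (for a cycle $Z$ on $[n]$, $\mathrm{Link}_n(Z)$ is a $(d-2)$-cycle on $[n-1]$). -}

module Defs where

open import Data.Nat using (ℕ; zero; suc; _≡ᵇ_)
open import Data.Bool using (Bool; true; false; _∧_; _xor_; not)
open import Data.List using (List; []; _∷_; map; _++_; foldr)
open import Data.Vec using ([]; _∷_)
open import Data.Fin using (Fin; fromℕ)
open import Data.Fin.Subset using (Subset; ⊤; ⁅_⁆; _∪_; _-_; _⊆_; ∣_∣)
open import Data.Fin.Subset.Properties using (_⊆?_; _∈?_)
open import Data.Product using (_×_)
open import Relation.Nullary using (does)
open import Relation.Binary.PropositionalEquality using (_≡_)

-- A chain on the vertex set Fin n : the characteristic function (over F₂,
-- i.e. Bool) of a set of simplices; simplices are subsets of Fin n.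
Chain : ℕ → Set
Chain n = Subset n → Bool

module _ {n : ℕ} where

  _⊕_ : Chain n → Chain n → Chain n
  (X ⊕ Y) σ = X σ xor Y σ
  infixl 6 _⊕_

  _≈_ : Chain n → Chain n → Set
  X ≈ Y = ∀ σ → X σ ≡ Y σ
  infix 4 _≈_

  _⊆ᶜ_ : Chain n → Chain n → Set
  X ⊆ᶜ Y = ∀ σ → X σ ≡ true → Y σ ≡ true
  infix 4 _⊆ᶜ_

  ∅ᶜ : Chain n
  ∅ᶜ _ = false

subsets : (n : ℕ) → List (Subset n)
subsets zero = [] ∷ []
subsets (suc n) = map (true ∷_) (subsets n) ++ map (false ∷_) (subsets n)

parity : List Bool → Bool
parity = foldr _xor_ false

module _ {n : ℕ} where

  -- Boundary of a set X of k-simplices: the set of (k-1)-simplices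
  -- (subsets with k vertices) contained in an odd number of members of X.
  ∂ : ℕ → Chain n → Chain n
  ∂ k X τ = (∣ τ ∣ ≡ᵇ k) ∧ parity (map (λ σ → X σ ∧ does (τ ⊆? σ)) (subsets n))

  -- X is a set of k-simplices (k+1 vertices) whose vertices lie in V
  IsChainOn : ℕ → Subset n → Chain n → Set
  IsChainOn k V X = ∀ σ → X σ ≡ true → (∣ σ ∣ ≡ suc k) × (σ ⊆ V)

  IsCycle : ℕ → Subset n → Chain n → Set
  IsCycle k V Z = IsChainOn k V Z × (∂ k Z ≈ ∅ᶜ)

  IsForest : ℕ → Subset n → Chain n → Set
  IsForest k V X = IsChainOn k V X × (∀ Y → Y ⊆ᶜ X → ∂ k Y ≈ ∅ᶜ → Y ≈ ∅ᶜ)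

  IsHypertree : ℕ → Subset n → Chain n → Set
  IsHypertree k V T = IsForest k V T × (∀ X → IsForest k V X → T ⊆ᶜ X → X ⊆ᶜ T)

  IsFill : ℕ → Chain n → Chain n → Chain n → Set
  IsFill k Z T F = (F ⊆ᶜ T) × (∂ k F ≈ Z) × (∀ H → H ⊆ᶜ T → ∂ k H ≈ Z → H ≈ F)

  -- Cone_v(Y) = { σ ∪ {v} : σ ∈ Y }  (for Y whose members avoid v)
  Cone : Fin n → Chain n → Chain n
  Cone v Y σ = does (v ∈? σ) ∧ Y (σ - v)

  Link : Fin n → Chain n → Chain n
  Link v X τ = not (does (v ∈? τ)) ∧ X (⁅ v ⁆ ∪ τ)

-- For the vertex set [n] = Fin (suc m): the last vertex "n" and the set [n-1]
lastV : (m : ℕ) → Fin (suc m)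
lastV m = fromℕ m

initV : (m : ℕ) → Subset (suc m)
initV m = ⊤ - lastV m

module Submission where

-- The argument:
--  * Boundary calculus over F₂ (boundaries are sums over all subsets, ⨁):
--    ∂ is linear, ∂(Cone v Y) = Y ⊕ Cone v (∂Y), every chain is its deletion
--    plus the cone over its link, the link of a cycle is a cycle, and a cycle X
--    is the boundary of Cone v (Del v X) ("cone construction").
--  * Hypertrees: a subset of an acyclic set is determined by its boundary, so
--    it is the fill; in a hypertree T on V every boundary of a chain on V has a
--    fill, because by maximality (and an exhaustive, decidable search over the
--    finitely many chains) the boundary of each simplex on V is filled in T.
--  * The theorem: Link N Z bounds on V, so F = Fill(Link N Z, T′) exists; then
--    Z′ = Z ⊕ Cone N (Link N Z) ⊕ F is a cycle on V, so G = Fill(Z′, T) exists;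
--    Cone N F ⊕ G lies in S with boundary Z, and S is acyclic, hence it is
--    Fill(Z, S).

open import Defs
open import Algebra.Bundles using (CommutativeRing)
open import Algebra.Properties.CommutativeSemigroup using (interchange)
open import Data.Bool using (Bool; true; false; _∧_; _∨_; _xor_; not; T)
import Data.Bool as Bool
open import Data.Bool.Properties
  using (not-injective; xor-assoc; xor-comm; xor-same; xor-identityʳ; ∧-distribˡ-xor; ∧-distribʳ-xor; ∧-zeroʳ; ∧-identityʳ;
         ∨-identityʳ; ∨-zeroʳ; ∧-comm; xor-∧-commutativeRing)
open import Data.Empty using (⊥-elim)
open import Data.Fin using (Fin; zero; suc)
open import Data.Fin.Subset using (Subset; ⊤; ⊥; ⁅_⁆; _∪_; _-_; _─_; _⊆_; ∣_∣)
open import Data.Fin.Subset.Properties using (_⊆?_; _∈?_; anySubset?; ∪-identityˡ; p─⊥≡p; p⊆q⇒∣p∣≤∣q∣; ⊆⊤)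
open import Data.List using (List; []; _∷_; map; _++_)
open import Data.List.Properties using (map-++; map-∘)
open import Data.Nat using (ℕ; zero; suc; _≤_; _≡ᵇ_)
open import Data.Nat.Properties using (suc-injective; ≡ᵇ⇒≡; n≮n)
open import Data.Product using (Σ; _×_; _,_; proj₁; proj₂; Σ-syntax)
open import Data.Sum using (_⊎_; inj₁; inj₂)
open import Data.Unit using (tt)
open import Data.Vec using ([]; _∷_)
open import Data.Vec.Properties using (≡-dec)
open import Relation.Nullary using (does; Dec; yes; no; ¬_)
open import Relation.Nullary.Decidable using (dec-true; dec-false; decidable-stable; ¬?; _×-dec_)
open import Relation.Binary.PropositionalEquality
  using (_≡_; _≢_; refl; sym; trans; cong; cong₂; subst; module ≡-Reasoning)

xor-interchange : ∀ a b c d → (a xor b) xor (c xor d) ≡ (a xor c) xor (b xor d)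
xor-interchange = interchange (CommutativeRing.+-commutativeSemigroup xor-∧-commutativeRing)

true≢false : true ≢ false
true≢false ()

xor-cancel : ∀ a b → a xor b ≡ false → a ≡ b
xor-cancel true  true  _ = refl
xor-cancel false false _ = refl

xor-true : ∀ a b → a xor b ≡ true → a ≡ true ⊎ b ≡ true
xor-true true  b _ = inj₁ refl
xor-true false b e = inj₂ e

xor-move : ∀ a b c → a ≡ b xor c → a xor c ≡ b
xor-move _ true  true  refl = refl
xor-move _ true  false refl = refl
xor-move _ false true  refl = refl
xor-move _ false false refl = refl

guarded : ∀ a {b c} → (a ≡ true → b ≡ c) → a ∧ b ≡ a ∧ c
guarded true  b≡c = b≡c refl
guarded false _   = refl

true-or-false : ∀ b → b ≡ true ⊎ b ≡ false
true-or-false true  = inj₁ refl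
true-or-false false = inj₂ refl

-- The cancellation that makes the fill formula work: c and a occur twice.
xor-cancel-pairs : ∀ a c z → (a xor c) xor ((z xor c) xor a) ≡ z
xor-cancel-pairs true  true  true  = refl
xor-cancel-pairs true  true  false = refl
xor-cancel-pairs true  false true  = refl
xor-cancel-pairs true  false false = refl
xor-cancel-pairs false true  true  = refl
xor-cancel-pairs false true  false = refl
xor-cancel-pairs false false true  = refl
xor-cancel-pairs false false false = refl

does-true : ∀ {a} {A : Set a} (a? : Dec A) → does a? ≡ true → A
does-true (yes a) _ = a

≡ᵇ-sound : ∀ m k → (m ≡ᵇ k) ≡ true → m ≡ k
≡ᵇ-sound m k e = ≡ᵇ⇒≡ m k (subst T (sym e) tt)

≡ᵇ-refl : ∀ k → (k ≡ᵇ k) ≡ true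
≡ᵇ-refl zero    = refl
≡ᵇ-refl (suc k) = ≡ᵇ-refl k

module _ {n : ℕ} where

  infix 4.5 _∈ᵇ_ _⊆ᵇ_

  _∈ᵇ_ : Fin n → Subset n → Bool
  v ∈ᵇ σ = does (v ∈? σ)

  _⊆ᵇ_ : Subset n → Subset n → Bool
  τ ⊆ᵇ σ = does (τ ⊆? σ)

  _≟ˢ_ : (σ τ : Subset n) → Dec (σ ≡ τ)
  _≟ˢ_ = ≡-dec Bool._≟_

  ⟪_⟫ : Subset n → Chain n
  ⟪ σ ⟫ τ = does (σ ≟ˢ τ)


∈ᵇ-insert : ∀ {n} (v : Fin n) ρ → v ∈ᵇ ⁅ v ⁆ ∪ ρ ≡ true
∈ᵇ-insert zero    (b ∷ ρ) = refl
∈ᵇ-insert (suc v) (b ∷ ρ) = ∈ᵇ-insert v ρ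

∈ᵇ-delete : ∀ {n} (v : Fin n) σ → v ∈ᵇ σ - v ≡ false
∈ᵇ-delete zero    (b ∷ σ) = refl
∈ᵇ-delete (suc v) (b ∷ σ) = ∈ᵇ-delete v σ

delete-insert : ∀ {n} (v : Fin n) ρ → v ∈ᵇ ρ ≡ false → (⁅ v ⁆ ∪ ρ) - v ≡ ρ
delete-insert zero    (false ∷ ρ) _ = cong (false ∷_) (trans (cong (_─ ⊥) (∪-identityˡ ρ)) (p─⊥≡p ρ))
delete-insert (suc v) (b ∷ ρ)     e = cong (b ∷_) (delete-insert v ρ e)

insert-delete : ∀ {n} (v : Fin n) σ → v ∈ᵇ σ ≡ true → ⁅ v ⁆ ∪ (σ - v) ≡ σ
insert-delete zero    (true ∷ σ) _ = cong (true ∷_) (trans (∪-identityˡ (σ ─ ⊥)) (p─⊥≡p σ))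
insert-delete (suc v) (b ∷ σ)    e = cong (b ∷_) (insert-delete v σ e)

∣insert∣ : ∀ {n} (v : Fin n) ρ → v ∈ᵇ ρ ≡ false → ∣ ⁅ v ⁆ ∪ ρ ∣ ≡ suc ∣ ρ ∣
∣insert∣ zero    (false ∷ ρ) _ = cong (λ ρ′ → suc ∣ ρ′ ∣) (∪-identityˡ ρ)
∣insert∣ (suc v) (true ∷ ρ)  e = cong suc (∣insert∣ v ρ e)
∣insert∣ (suc v) (false ∷ ρ) e = ∣insert∣ v ρ e

∣delete∣ : ∀ {n} (v : Fin n) σ → v ∈ᵇ σ ≡ true → ∣ σ ∣ ≡ suc ∣ σ - v ∣
∣delete∣ v σ e = trans (cong ∣_∣ (sym (insert-delete v σ e))) (∣insert∣ v (σ - v) (∈ᵇ-delete v σ))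

∈ᵇ-delete-other : ∀ {n} (w v : Fin n) σ → w ≢ v → w ∈ᵇ σ - v ≡ w ∈ᵇ σ
∈ᵇ-delete-other zero    zero    σ       w≢v = ⊥-elim (w≢v refl)
∈ᵇ-delete-other zero    (suc v) (true ∷ σ)  _ = refl
∈ᵇ-delete-other zero    (suc v) (false ∷ σ) _ = refl
∈ᵇ-delete-other (suc w) zero    (b ∷ σ) _   = cong (w ∈ᵇ_) (p─⊥≡p σ)
∈ᵇ-delete-other (suc w) (suc v) (b ∷ σ) w≢v = ∈ᵇ-delete-other w v σ (λ w≡v → w≢v (cong suc w≡v))

∈ᵇ-empty : ∀ {n} (v : Fin n) σ → ∣ σ ∣ ≡ 0 → v ∈ᵇ σ ≡ false
∈ᵇ-empty zero    (false ∷ σ) _ = refl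
∈ᵇ-empty (suc v) (false ∷ σ) c = ∈ᵇ-empty v σ c

⊆ᵇ-insert-∉ : ∀ {n} (v : Fin n) τ ρ → v ∈ᵇ τ ≡ false → τ ⊆ᵇ ⁅ v ⁆ ∪ ρ ≡ τ ⊆ᵇ ρ
⊆ᵇ-insert-∉ zero    (false ∷ τ) (b ∷ ρ)     _ = cong (τ ⊆ᵇ_) (∪-identityˡ ρ)
⊆ᵇ-insert-∉ (suc v) (false ∷ τ) (b ∷ ρ)     e = ⊆ᵇ-insert-∉ v τ ρ e
⊆ᵇ-insert-∉ (suc v) (true ∷ τ)  (true ∷ ρ)  e = ⊆ᵇ-insert-∉ v τ ρ e
⊆ᵇ-insert-∉ (suc v) (true ∷ τ)  (false ∷ ρ) _ = refl

⊆ᵇ-insert-∈ : ∀ {n} (v : Fin n) τ ρ → v ∈ᵇ τ ≡ true → τ ⊆ᵇ ⁅ v ⁆ ∪ ρ ≡ τ - v ⊆ᵇ ρ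
⊆ᵇ-insert-∈ zero    (true ∷ τ)  (b ∷ ρ)     _ =
  trans (cong (τ ⊆ᵇ_) (∪-identityˡ ρ)) (cong (_⊆ᵇ ρ) (sym (p─⊥≡p τ)))
⊆ᵇ-insert-∈ (suc v) (false ∷ τ) (b ∷ ρ)     e = ⊆ᵇ-insert-∈ v τ ρ e
⊆ᵇ-insert-∈ (suc v) (true ∷ τ)  (true ∷ ρ)  e = ⊆ᵇ-insert-∈ v τ ρ e
⊆ᵇ-insert-∈ (suc v) (true ∷ τ)  (false ∷ ρ) _ = refl

⊆ᵇ-refl : ∀ {n} (τ : Subset n) → τ ⊆ᵇ τ ≡ true
⊆ᵇ-refl []          = refl
⊆ᵇ-refl (false ∷ τ) = ⊆ᵇ-refl τ
⊆ᵇ-refl (true ∷ τ)  = ⊆ᵇ-refl τ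

⊆ᵇ-same-size : ∀ {n} (τ ρ : Subset n) → τ ⊆ᵇ ρ ≡ true → ∣ τ ∣ ≡ ∣ ρ ∣ → τ ≡ ρ
⊆ᵇ-same-size []          []          _ _ = refl
⊆ᵇ-same-size (false ∷ τ) (false ∷ ρ) s c = cong (false ∷_) (⊆ᵇ-same-size τ ρ s c)
⊆ᵇ-same-size (true ∷ τ)  (true ∷ ρ)  s c = cong (true ∷_) (⊆ᵇ-same-size τ ρ s (suc-injective c))
⊆ᵇ-same-size (false ∷ τ) (true ∷ ρ)  s c =
  ⊥-elim (n≮n ∣ ρ ∣ (subst (_≤ ∣ ρ ∣) c (p⊆q⇒∣p∣≤∣q∣ (does-true (τ ⊆? ρ) s))))

⊆ᵇ-∈ᵇ : ∀ {n} (v : Fin n) τ σ → τ ⊆ᵇ σ ≡ true → v ∈ᵇ τ ≡ true → v ∈ᵇ σ ≡ true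
⊆ᵇ-∈ᵇ v τ σ s m = dec-true (v ∈? σ) (does-true (τ ⊆? σ) s (does-true (v ∈? τ) m))

⊆ᵇ-all-but : ∀ {n} (v : Fin n) σ → σ ⊆ᵇ ⊤ - v ≡ not (v ∈ᵇ σ)
⊆ᵇ-all-but zero    (false ∷ σ) = trans (cong (σ ⊆ᵇ_) (p─⊥≡p ⊤)) (dec-true (σ ⊆? ⊤) ⊆⊤)
⊆ᵇ-all-but zero    (true ∷ σ)  = refl
⊆ᵇ-all-but (suc v) (false ∷ σ) = ⊆ᵇ-all-but v σ
⊆ᵇ-all-but (suc v) (true ∷ σ)  = ⊆ᵇ-all-but v σ

-- ⨁ f is the F₂-sum of f over all subsets of Fin n.  The boundary operator of
-- Defs is such a sum, written as the parity of a list (parity-subsets).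
⨁ : ∀ {n} → (Subset n → Bool) → Bool
⨁ {zero}  f = f []
⨁ {suc n} f = ⨁ (λ ρ → f (true ∷ ρ)) xor ⨁ (λ ρ → f (false ∷ ρ))

parity-++ : ∀ xs ys → parity (xs ++ ys) ≡ parity xs xor parity ys
parity-++ []       ys = refl
parity-++ (x ∷ xs) ys = trans (cong (x xor_) (parity-++ xs ys)) (sym (xor-assoc x (parity xs) (parity ys)))

parity-subsets : ∀ {n} (f : Subset n → Bool) → parity (map f (subsets n)) ≡ ⨁ f
parity-subsets {zero}  f = xor-identityʳ (f [])
parity-subsets {suc n} f = begin
  parity (map f (map (true ∷_) (subsets n) ++ map (false ∷_) (subsets n)))
    ≡⟨ cong parity (map-++ f (map (true ∷_) (subsets n)) (map (false ∷_) (subsets n))) ⟩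
  parity (map f (map (true ∷_) (subsets n)) ++ map f (map (false ∷_) (subsets n)))
    ≡⟨ parity-++ (map f (map (true ∷_) (subsets n))) (map f (map (false ∷_) (subsets n))) ⟩
  parity (map f (map (true ∷_) (subsets n))) xor parity (map f (map (false ∷_) (subsets n)))
    ≡⟨ cong₂ _xor_ (half true) (half false) ⟩
  ⨁ f ∎
  where
  open ≡-Reasoning
  half : ∀ b → parity (map f (map (b ∷_) (subsets n))) ≡ ⨁ (λ ρ → f (b ∷ ρ))
  half b = trans (cong parity (sym (map-∘ (subsets n)))) (parity-subsets (λ ρ → f (b ∷ ρ)))

⨁-cong : ∀ {n} {f g : Subset n → Bool} → (∀ ρ → f ρ ≡ g ρ) → ⨁ f ≡ ⨁ g
⨁-cong {zero}  e = e []
⨁-cong {suc n} e = cong₂ _xor_ (⨁-cong (λ ρ → e (true ∷ ρ))) (⨁-cong (λ ρ → e (false ∷ ρ)))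

⨁-xor : ∀ {n} (f g : Subset n → Bool) → ⨁ (λ ρ → f ρ xor g ρ) ≡ ⨁ f xor ⨁ g
⨁-xor {zero}  f g = refl
⨁-xor {suc n} f g =
  trans (cong₂ _xor_ (⨁-xor (λ ρ → f (true ∷ ρ)) (λ ρ → g (true ∷ ρ)))
                     (⨁-xor (λ ρ → f (false ∷ ρ)) (λ ρ → g (false ∷ ρ))))
        (xor-interchange (⨁ (λ ρ → f (true ∷ ρ))) (⨁ (λ ρ → g (true ∷ ρ)))
                         (⨁ (λ ρ → f (false ∷ ρ))) (⨁ (λ ρ → g (false ∷ ρ))))

⨁-zero : ∀ {n} {f : Subset n → Bool} → (∀ ρ → f ρ ≡ false) → ⨁ f ≡ false
⨁-zero {zero}  e = e []
⨁-zero {suc n} e = cong₂ _xor_ (⨁-zero (λ ρ → e (true ∷ ρ))) (⨁-zero (λ ρ → e (false ∷ ρ)))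

⨁-false : ∀ {n} → ⨁ {n} (λ _ → false) ≡ false
⨁-false {n} = ⨁-zero {n} {λ _ → false} (λ _ → refl)

⨁-point : ∀ {n} (τ : Subset n) (g : Subset n → Bool) → ⨁ (λ ρ → ⟪ ρ ⟫ τ ∧ g ρ) ≡ g τ
⨁-point         []          g = refl
⨁-point {suc n} (true ∷ τ)  g =
  trans (cong₂ _xor_ (⨁-point τ (λ ρ → g (true ∷ ρ))) (⨁-false {n})) (xor-identityʳ _)
⨁-point {suc n} (false ∷ τ) g = cong₂ _xor_ (⨁-false {n}) (⨁-point τ (λ ρ → g (false ∷ ρ)))

-- Splitting a sum according to whether a vertex v belongs to the subset:
-- the subsets containing v are exactly the ⁅ v ⁆ ∪ ρ with ρ ∌ v.
⨁-split : ∀ {n} (v : Fin n) (f : Subset n → Bool) →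
  ⨁ f ≡ ⨁ (λ ρ → not (v ∈ᵇ ρ) ∧ f ρ) xor ⨁ (λ ρ → not (v ∈ᵇ ρ) ∧ f (⁅ v ⁆ ∪ ρ))
⨁-split {suc n} zero f = sym (begin
  (⨁ {n} (λ _ → false) xor outside) xor (⨁ {n} (λ _ → false) xor inside′)
    ≡⟨ cong₂ (λ x y → (x xor outside) xor (y xor inside′)) (⨁-false {n}) (⨁-false {n}) ⟩
  outside xor inside′
    ≡⟨ cong (outside xor_) (⨁-cong (λ ρ → cong (λ ρ′ → f (true ∷ ρ′)) (∪-identityˡ ρ))) ⟩
  outside xor inside
    ≡⟨ xor-comm outside inside ⟩
  inside xor outside ∎)
  where
  open ≡-Reasoning
  inside outside inside′ : Bool
  inside    = ⨁ (λ ρ → f (true ∷ ρ))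
  outside = ⨁ (λ ρ → f (false ∷ ρ))
  inside′   = ⨁ (λ ρ → f (true ∷ (⊥ ∪ ρ)))
⨁-split {suc n} (suc v) f =
  trans (cong₂ _xor_ (⨁-split v (λ ρ → f (true ∷ ρ))) (⨁-split v (λ ρ → f (false ∷ ρ))))
        (xor-interchange (⨁ (λ ρ → not (v ∈ᵇ ρ) ∧ f (true ∷ ρ))) (⨁ (λ ρ → not (v ∈ᵇ ρ) ∧ f (true ∷ (⁅ v ⁆ ∪ ρ))))
                         (⨁ (λ ρ → not (v ∈ᵇ ρ) ∧ f (false ∷ ρ))) (⨁ (λ ρ → not (v ∈ᵇ ρ) ∧ f (false ∷ (⁅ v ⁆ ∪ ρ)))))

module _ {n : ℕ} where

  Avoids : Fin n → Chain n → Set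
  Avoids v X = ∀ σ → X σ ≡ true → v ∈ᵇ σ ≡ false

  Sized : ℕ → Chain n → Set
  Sized k X = ∀ σ → X σ ≡ true → ∣ σ ∣ ≡ k

  Del : Fin n → Chain n → Chain n
  Del v X σ = not (v ∈ᵇ σ) ∧ X σ

  avoids-off : ∀ v {X} σ → Avoids v X → v ∈ᵇ σ ≡ true → X σ ≡ false
  avoids-off v {X} σ av v∈σ with X σ in eX
  ... | false = refl
  ... | true  with trans (sym v∈σ) (av σ eX)
  ...   | ()

  ∂-sum : ∀ k (X : Chain n) τ → ∂ k X τ ≡ (∣ τ ∣ ≡ᵇ k) ∧ ⨁ (λ σ → X σ ∧ (τ ⊆ᵇ σ))
  ∂-sum k X τ = cong ((∣ τ ∣ ≡ᵇ k) ∧_) (parity-subsets (λ σ → X σ ∧ (τ ⊆ᵇ σ)))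

  ∂-cong : ∀ k {X Y : Chain n} → X ≈ Y → ∂ k X ≈ ∂ k Y
  ∂-cong k {X} {Y} X≈Y τ = begin
    ∂ k X τ                                          ≡⟨ ∂-sum k X τ ⟩
    (∣ τ ∣ ≡ᵇ k) ∧ ⨁ (λ σ → X σ ∧ (τ ⊆ᵇ σ))           ≡⟨ cong ((∣ τ ∣ ≡ᵇ k) ∧_) (⨁-cong (λ σ → cong (_∧ (τ ⊆ᵇ σ)) (X≈Y σ))) ⟩
    (∣ τ ∣ ≡ᵇ k) ∧ ⨁ (λ σ → Y σ ∧ (τ ⊆ᵇ σ))           ≡⟨ sym (∂-sum k Y τ) ⟩
    ∂ k Y τ                                          ∎
    where open ≡-Reasoning

  ∂-⊕ : ∀ k (X Y : Chain n) → ∂ k (X ⊕ Y) ≈ ∂ k X ⊕ ∂ k Y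
  ∂-⊕ k X Y τ = begin
    ∂ k (X ⊕ Y) τ
      ≡⟨ ∂-sum k (X ⊕ Y) τ ⟩
    (∣ τ ∣ ≡ᵇ k) ∧ ⨁ (λ σ → (X σ xor Y σ) ∧ (τ ⊆ᵇ σ))
      ≡⟨ cong ((∣ τ ∣ ≡ᵇ k) ∧_) (⨁-cong (λ σ → ∧-distribʳ-xor (τ ⊆ᵇ σ) (X σ) (Y σ))) ⟩
    (∣ τ ∣ ≡ᵇ k) ∧ ⨁ (λ σ → (X σ ∧ (τ ⊆ᵇ σ)) xor (Y σ ∧ (τ ⊆ᵇ σ)))
      ≡⟨ cong ((∣ τ ∣ ≡ᵇ k) ∧_) (⨁-xor (λ σ → X σ ∧ (τ ⊆ᵇ σ)) (λ σ → Y σ ∧ (τ ⊆ᵇ σ))) ⟩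
    (∣ τ ∣ ≡ᵇ k) ∧ (⨁ (λ σ → X σ ∧ (τ ⊆ᵇ σ)) xor ⨁ (λ σ → Y σ ∧ (τ ⊆ᵇ σ)))
      ≡⟨ ∧-distribˡ-xor (∣ τ ∣ ≡ᵇ k) _ _ ⟩
    ((∣ τ ∣ ≡ᵇ k) ∧ ⨁ (λ σ → X σ ∧ (τ ⊆ᵇ σ))) xor ((∣ τ ∣ ≡ᵇ k) ∧ ⨁ (λ σ → Y σ ∧ (τ ⊆ᵇ σ)))
      ≡⟨ sym (cong₂ _xor_ (∂-sum k X τ) (∂-sum k Y τ)) ⟩
    ∂ k X τ xor ∂ k Y τ ∎
    where open ≡-Reasoning

  ∂-avoids : ∀ k v (X : Chain n) τ → Avoids v X → v ∈ᵇ τ ≡ true → ∂ k X τ ≡ false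
  ∂-avoids k v X τ av v∈τ =
    trans (∂-sum k X τ) (trans (cong ((∣ τ ∣ ≡ᵇ k) ∧_) (⨁-zero no-coface)) (∧-zeroʳ (∣ τ ∣ ≡ᵇ k)))
    where
    no-coface : ∀ σ → X σ ∧ (τ ⊆ᵇ σ) ≡ false
    no-coface σ with X σ in eX | τ ⊆ᵇ σ in τ⊆σ
    ... | false | _     = refl
    ... | true  | false = refl
    ... | true  | true  with trans (sym (av σ eX)) (⊆ᵇ-∈ᵇ v τ σ τ⊆σ v∈τ)
    ...   | ()

  -- Among k-vertex simplices, the only one containing a k-vertex τ is τ itself;
  -- so the "coface sum" of a k-vertex chain Y at τ just reads off Y τ.
  coface-sum : ∀ k (Y : Chain n) τ → Sized k Y → (∣ τ ∣ ≡ᵇ k) ∧ ⨁ (λ ρ → Y ρ ∧ (τ ⊆ᵇ ρ)) ≡ Y τ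
  coface-sum k Y τ sz with ∣ τ ∣ ≡ᵇ k in ∣τ∣≡k | Y τ in eY
  ... | false | false = refl
  ... | false | true  with trans (sym (≡ᵇ-refl k)) (trans (cong (_≡ᵇ k) (sym (sz τ eY))) ∣τ∣≡k)
  ...   | ()
  coface-sum k Y τ sz | true | b =
    trans (⨁-cong only-τ) (trans (⨁-point τ Y) eY)
    where
    only-τ : ∀ ρ → Y ρ ∧ (τ ⊆ᵇ ρ) ≡ ⟪ ρ ⟫ τ ∧ Y ρ
    only-τ ρ with ρ ≟ˢ τ
    ... | yes refl = trans (cong (Y ρ ∧_) (⊆ᵇ-refl ρ)) (∧-identityʳ (Y ρ))
    ... | no ρ≢τ with Y ρ in eYρ | τ ⊆ᵇ ρ in τ⊆ρ
    ...   | false | _     = refl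
    ...   | true  | false = refl
    ...   | true  | true  =
      ⊥-elim (ρ≢τ (sym (⊆ᵇ-same-size τ ρ τ⊆ρ (trans (≡ᵇ-sound _ _ ∣τ∣≡k) (sym (sz ρ eYρ))))))

  ⨁-Cone : ∀ v (Y : Chain n) (g : Subset n → Bool) → Avoids v Y →
           ⨁ (λ σ → Cone v Y σ ∧ g σ) ≡ ⨁ (λ ρ → Y ρ ∧ g (⁅ v ⁆ ∪ ρ))
  ⨁-Cone v Y g av =
    trans (⨁-split v (λ σ → Cone v Y σ ∧ g σ))
          (cong₂ _xor_ (⨁-zero off-apex) (⨁-cong through-apex))
    where
    off-apex : ∀ ρ → not (v ∈ᵇ ρ) ∧ (Cone v Y ρ ∧ g ρ) ≡ false
    off-apex ρ with v ∈ᵇ ρ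
    ... | true  = refl
    ... | false = refl
    through-apex : ∀ ρ → not (v ∈ᵇ ρ) ∧ (Cone v Y (⁅ v ⁆ ∪ ρ) ∧ g (⁅ v ⁆ ∪ ρ)) ≡ Y ρ ∧ g (⁅ v ⁆ ∪ ρ)
    through-apex ρ with v ∈ᵇ ρ in v∈ρ
    ... | false rewrite ∈ᵇ-insert v ρ | delete-insert v ρ v∈ρ = refl
    ... | true  rewrite avoids-off v ρ av v∈ρ = refl

  -- The faces of Cone v Y through the apex v, as they occur in ∂ k (Cone v Y):
  -- a k-vertex τ ∋ v counted once for each simplex of Y containing τ - v.
  apexFaces : ℕ → Fin n → Chain n → Chain n
  apexFaces k v Y τ = (v ∈ᵇ τ) ∧ ((∣ τ ∣ ≡ᵇ k) ∧ ⨁ (λ ρ → Y ρ ∧ (τ - v ⊆ᵇ ρ)))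

  apexFaces-off : ∀ k v (Y : Chain n) τ → v ∈ᵇ τ ≡ false → apexFaces k v Y τ ≡ false
  apexFaces-off k v Y τ v∉τ rewrite v∉τ = refl

  ∂-Cone : ∀ k v (Y : Chain n) → Avoids v Y → Sized k Y → ∂ k (Cone v Y) ≈ Y ⊕ apexFaces k v Y
  ∂-Cone k v Y av sz τ =
    trans (∂-sum k (Cone v Y) τ) (trans (cong ((∣ τ ∣ ≡ᵇ k) ∧_) (⨁-Cone v Y (τ ⊆ᵇ_) av)) (by-apex (v ∈ᵇ τ) refl))
    where
    faces : (Subset n → Bool) → Bool
    faces g = (∣ τ ∣ ≡ᵇ k) ∧ ⨁ (λ ρ → Y ρ ∧ g ρ)
    by-apex : ∀ b → v ∈ᵇ τ ≡ b → faces (λ ρ → τ ⊆ᵇ ⁅ v ⁆ ∪ ρ) ≡ Y τ xor apexFaces k v Y τ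
    by-apex false v∉τ = begin
      faces (λ ρ → τ ⊆ᵇ ⁅ v ⁆ ∪ ρ) ≡⟨ cong ((∣ τ ∣ ≡ᵇ k) ∧_) (⨁-cong (λ ρ → cong (Y ρ ∧_) (⊆ᵇ-insert-∉ v τ ρ v∉τ))) ⟩
      faces (τ ⊆ᵇ_)                ≡⟨ coface-sum k Y τ sz ⟩
      Y τ                          ≡⟨ sym (xor-identityʳ (Y τ)) ⟩
      Y τ xor false                ≡⟨ cong (Y τ xor_) (sym (apexFaces-off k v Y τ v∉τ)) ⟩
      Y τ xor apexFaces k v Y τ    ∎
      where open ≡-Reasoning
    by-apex true v∈τ = begin
      faces (λ ρ → τ ⊆ᵇ ⁅ v ⁆ ∪ ρ) ≡⟨ cong ((∣ τ ∣ ≡ᵇ k) ∧_) (⨁-cong (λ ρ → cong (Y ρ ∧_) (⊆ᵇ-insert-∈ v τ ρ v∈τ))) ⟩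
      faces (λ ρ → τ - v ⊆ᵇ ρ)     ≡⟨ cong (_∧ faces (λ ρ → τ - v ⊆ᵇ ρ)) (sym v∈τ) ⟩
      apexFaces k v Y τ            ≡⟨ cong (_xor apexFaces k v Y τ) (sym (avoids-off v τ av v∈τ)) ⟩
      Y τ xor apexFaces k v Y τ    ∎
      where open ≡-Reasoning

  apexFaces-suc : ∀ j v (Y : Chain n) → apexFaces (suc j) v Y ≈ Cone v (∂ j Y)
  apexFaces-suc j v Y τ = guarded (v ∈ᵇ τ) λ v∈τ →
    trans (cong (λ m → (m ≡ᵇ suc j) ∧ ⨁ (λ ρ → Y ρ ∧ (τ - v ⊆ᵇ ρ))) (∣delete∣ v τ v∈τ)) (sym (∂-sum j Y (τ - v)))

  apexFaces-zero : ∀ v (Y : Chain n) → apexFaces 0 v Y ≈ ∅ᶜ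
  apexFaces-zero v Y τ = trans
    (guarded (v ∈ᵇ τ) (λ v∈τ → cong (λ m → (m ≡ᵇ 0) ∧ ⨁ (λ ρ → Y ρ ∧ (τ - v ⊆ᵇ ρ))) (∣delete∣ v τ v∈τ)))
    (∧-zeroʳ (v ∈ᵇ τ))

  ∂-Cone-suc : ∀ j v (Y : Chain n) → Avoids v Y → Sized (suc j) Y → ∂ (suc j) (Cone v Y) ≈ Y ⊕ Cone v (∂ j Y)
  ∂-Cone-suc j v Y av sz τ = trans (∂-Cone (suc j) v Y av sz τ) (cong (Y τ xor_) (apexFaces-suc j v Y τ))

  ∂-Cone-zero : ∀ v (Y : Chain n) → Avoids v Y → Sized 0 Y → ∂ 0 (Cone v Y) ≈ Y
  ∂-Cone-zero v Y av sz τ =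
    trans (∂-Cone 0 v Y av sz τ) (trans (cong (Y τ xor_) (apexFaces-zero v Y τ)) (xor-identityʳ (Y τ)))

  Del-Link : ∀ v (X : Chain n) → X ≈ Del v X ⊕ Cone v (Link v X)
  Del-Link v X σ with v ∈ᵇ σ in v∈σ
  ... | false = sym (xor-identityʳ (X σ))
  ... | true  rewrite ∈ᵇ-delete v σ | insert-delete v σ v∈σ = refl

  Del-avoids : ∀ v (X : Chain n) → Avoids v (Del v X)
  Del-avoids v X σ _ with v ∈ᵇ σ
  Del-avoids v X σ _  | false = refl
  Del-avoids v X σ () | true

  Del-avoids-other : ∀ w v (X : Chain n) → Avoids w X → Avoids w (Del v X)
  Del-avoids-other w v X av σ _ with v ∈ᵇ σ
  Del-avoids-other w v X av σ p  | false = av σ p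
  Del-avoids-other w v X av σ () | true

  Del-sized : ∀ k v (X : Chain n) → Sized k X → Sized k (Del v X)
  Del-sized k v X sz σ _ with v ∈ᵇ σ
  Del-sized k v X sz σ p  | false = sz σ p
  Del-sized k v X sz σ () | true

  Link-avoids : ∀ v (X : Chain n) → Avoids v (Link v X)
  Link-avoids v X τ _ with v ∈ᵇ τ
  Link-avoids v X τ _  | false = refl
  Link-avoids v X τ () | true

  Link-sized : ∀ k v (X : Chain n) → Sized (suc k) X → Sized k (Link v X)
  Link-sized k v X sz τ _ with v ∈ᵇ τ in v∈τ
  Link-sized k v X sz τ p  | false = suc-injective (trans (sym (∣insert∣ v τ v∈τ)) (sz _ p))
  Link-sized k v X sz τ () | true

  Cone-sized : ∀ k v (Y : Chain n) → Sized k Y → Sized (suc k) (Cone v Y)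
  Cone-sized k v Y sz σ _ with v ∈ᵇ σ in v∈σ
  Cone-sized k v Y sz σ p  | true = trans (∣delete∣ v σ v∈σ) (cong suc (sz _ p))
  Cone-sized k v Y sz σ () | false

  Cone-avoids-other : ∀ w v (Y : Chain n) → w ≢ v → Avoids w Y → Avoids w (Cone v Y)
  Cone-avoids-other w v Y w≢v av σ _ with v ∈ᵇ σ
  Cone-avoids-other w v Y w≢v av σ p  | true = trans (sym (∈ᵇ-delete-other w v σ w≢v)) (av _ p)
  Cone-avoids-other w v Y w≢v av σ () | false

  ⊕-sized : ∀ k {X Y : Chain n} → Sized k X → Sized k Y → Sized k (X ⊕ Y)
  ⊕-sized k {X} {Y} szX szY σ p with xor-true (X σ) (Y σ) p
  ... | inj₁ q = szX σ q
  ... | inj₂ q = szY σ q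

  ⊕-avoids : ∀ v {X Y : Chain n} → Avoids v X → Avoids v Y → Avoids v (X ⊕ Y)
  ⊕-avoids v {X} {Y} avX avY σ p with xor-true (X σ) (Y σ) p
  ... | inj₁ q = avX σ q
  ... | inj₂ q = avY σ q

  -- The link of a cycle is a cycle: at a face ⁅ v ⁆ ∪ ρ of the cycle X, the
  -- boundary of X reduces to the boundary of Link v X at ρ.
  ∂-Link : ∀ j v (X : Chain n) → Sized (suc (suc j)) X → ∂ (suc j) X ≈ ∅ᶜ → ∂ j (Link v X) ≈ ∅ᶜ
  ∂-Link j v X sz cyc ρ with v ∈ᵇ ρ in v∈ρ
  ... | true  = ∂-avoids j v (Link v X) ρ (Link-avoids v X) v∈ρ
  ... | false = begin
    ∂ j L ρ
      ≡⟨ cong (∂ j L) (sym (delete-insert v ρ v∈ρ)) ⟩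
    ∂ j L (τ - v)
      ≡⟨ cong (_∧ ∂ j L (τ - v)) (sym (∈ᵇ-insert v ρ)) ⟩
    Cone v (∂ j L) τ
      ≡⟨ cong (_xor Cone v (∂ j L) τ) (sym (avoids-off v τ (Link-avoids v X) (∈ᵇ-insert v ρ))) ⟩
    L τ xor Cone v (∂ j L) τ
      ≡⟨ sym (∂-Cone-suc j v L (Link-avoids v X) (Link-sized (suc j) v X sz) τ) ⟩
    ∂ (suc j) (Cone v L) τ
      ≡⟨ cong (_xor ∂ (suc j) (Cone v L) τ) (sym (∂-avoids (suc j) v (Del v X) τ (Del-avoids v X) (∈ᵇ-insert v ρ))) ⟩
    ∂ (suc j) (Del v X) τ xor ∂ (suc j) (Cone v L) τ
      ≡⟨ sym (∂-⊕ (suc j) (Del v X) (Cone v L) τ) ⟩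
    ∂ (suc j) (Del v X ⊕ Cone v L) τ
      ≡⟨ sym (∂-cong (suc j) (Del-Link v X) τ) ⟩
    ∂ (suc j) X τ
      ≡⟨ cyc τ ⟩
    false ∎
    where
    open ≡-Reasoning
    L : Chain n
    L = Link v X
    τ : Subset n
    τ = ⁅ v ⁆ ∪ ρ

  ∂-Cone-Link : ∀ k v (X : Chain n) → Sized (suc k) X → ∂ k X ≈ ∅ᶜ → ∂ k (Cone v (Link v X)) ≈ Link v X
  ∂-Cone-Link zero    v X sz cyc = ∂-Cone-zero v (Link v X) (Link-avoids v X) (Link-sized 0 v X sz)
  ∂-Cone-Link (suc j) v X sz cyc τ = begin
    ∂ (suc j) (Cone v L) τ        ≡⟨ ∂-Cone-suc j v L (Link-avoids v X) (Link-sized (suc j) v X sz) τ ⟩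
    L τ xor Cone v (∂ j L) τ      ≡⟨ cong (L τ xor_) (guarded (v ∈ᵇ τ) (λ _ → ∂-Link j v X sz cyc (τ - v))) ⟩
    L τ xor ((v ∈ᵇ τ) ∧ false)    ≡⟨ cong (L τ xor_) (∧-zeroʳ (v ∈ᵇ τ)) ⟩
    L τ xor false                 ≡⟨ xor-identityʳ (L τ) ⟩
    L τ                           ∎
    where
    open ≡-Reasoning
    L : Chain n
    L = Link v X

  cone-filling : ∀ k v (X : Chain n) → Sized (suc k) X → ∂ k X ≈ ∅ᶜ → ∂ (suc k) (Cone v (Del v X)) ≈ X
  cone-filling k v X sz cyc τ = begin
    ∂ (suc k) (Cone v R) τ     ≡⟨ ∂-Cone-suc k v R (Del-avoids v X) (Del-sized (suc k) v X sz) τ ⟩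
    R τ xor Cone v (∂ k R) τ   ≡⟨ cong (R τ xor_) (guarded (v ∈ᵇ τ) (λ _ → ∂R-off-v (τ - v) (∈ᵇ-delete v τ))) ⟩
    R τ xor Cone v L τ         ≡⟨ sym (Del-Link v X τ) ⟩
    X τ                        ∎
    where
    open ≡-Reasoning
    R L : Chain n
    R = Del v X
    L = Link v X
    ∂R-off-v : ∀ ρ → v ∈ᵇ ρ ≡ false → ∂ k R ρ ≡ L ρ
    ∂R-off-v ρ v∉ρ = begin
      ∂ k R ρ                          ≡⟨ ∂-cong k (λ σ → sym (xor-move (X σ) (R σ) (Cone v L σ) (Del-Link v X σ))) ρ ⟩
      ∂ k (X ⊕ Cone v L) ρ             ≡⟨ ∂-⊕ k X (Cone v L) ρ ⟩
      ∂ k X ρ xor ∂ k (Cone v L) ρ     ≡⟨ cong₂ _xor_ (cyc ρ) (∂-Cone k v L (Link-avoids v X) (Link-sized k v X sz) ρ) ⟩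
      L ρ xor apexFaces k v L ρ        ≡⟨ cong (L ρ xor_) (apexFaces-off k v L ρ v∉ρ) ⟩
      L ρ xor false                    ≡⟨ xor-identityʳ (L ρ) ⟩
      L ρ                              ∎

-- Chains on Fin n form a finite set, so a decidable property
-- of chains that respects ≈ either has a witness or provably has none.  A chain
-- on Fin (suc n) is glued from two chains on Fin n: its values on the subsets
-- containing vertex 0 and on those avoiding it, so the search recurses on n.

glue : ∀ {n} → Chain n → Chain n → Chain (suc n)
glue A B (true ∷ σ)  = A σ
glue A B (false ∷ σ) = B σ

Respects≈ : ∀ {n} → (Chain n → Set) → Set
Respects≈ {n} Q = ∀ {X Y : Chain n} → X ≈ Y → Q X → Q Y

search : ∀ {n} (Q : Chain n → Set) → Respects≈ Q → (∀ X → Dec (Q X)) → Dec (Σ (Chain n) Q)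
search {zero} Q resp Q? with Q? (λ _ → true) | Q? (λ _ → false)
... | yes q  | _      = yes (_ , q)
... | no _   | yes q  = yes (_ , q)
... | no ¬qt | no ¬qf = no λ { (X , q) → constant (X []) (resp (λ { [] → refl }) q) }
  where
  constant : ∀ b → ¬ Q (λ _ → b)
  constant true  = ¬qt
  constant false = ¬qf
search {suc n} Q resp Q?
  with search (λ A → Σ (Chain n) (λ B → Q (glue A B))) respᴬ
              (λ A → search (λ B → Q (glue A B)) (respᴮ A) (λ B → Q? (glue A B)))
  where
  respᴬ : Respects≈ (λ A → Σ (Chain n) (λ B → Q (glue A B)))
  respᴬ A≈A′ (B , q) = B , resp (λ { (true ∷ σ) → A≈A′ σ ; (false ∷ σ) → refl }) q
  respᴮ : ∀ A → Respects≈ (λ B → Q (glue A B))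
  respᴮ A B≈B′ = resp (λ { (true ∷ σ) → refl ; (false ∷ σ) → B≈B′ σ })
... | yes (A , B , q) = yes (glue A B , q)
... | no ¬q = no λ { (X , q) →
        ¬q ((λ σ → X (true ∷ σ)) , (λ σ → X (false ∷ σ)) , resp (λ { (true ∷ σ) → refl ; (false ∷ σ) → refl }) q) }

all? : ∀ {n} {P : Subset n → Set} → (∀ σ → Dec (P σ)) → Dec (∀ σ → P σ)
all? P? with anySubset? (λ σ → ¬? (P? σ))
... | yes (σ , ¬p) = no (λ p → ¬p (p σ))
... | no ¬∃        = yes (λ σ → decidable-stable (P? σ) (λ ¬p → ¬∃ (σ , ¬p)))

module _ {n : ℕ} where

  _≈?_ : (X Y : Chain n) → Dec (X ≈ Y)
  X ≈? Y = all? (λ σ → X σ Bool.≟ Y σ)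

  _⊆ᶜ?_ : (X Y : Chain n) → Dec (X ⊆ᶜ Y)
  X ⊆ᶜ? Y = all? (λ σ → implies (X σ) (Y σ))
    where
    implies : ∀ a b → Dec (a ≡ true → b ≡ true)
    implies a     true  = yes (λ _ → refl)
    implies false false = yes (λ ())
    implies true  false = no (λ f → true≢false (sym (f refl)))

  Acyclic : ℕ → Chain n → Set
  Acyclic k S = ∀ Y → Y ⊆ᶜ S → ∂ k Y ≈ ∅ᶜ → Y ≈ ∅ᶜ

  ⊕-⊆ᶜ : ∀ {X Y S : Chain n} → X ⊆ᶜ S → Y ⊆ᶜ S → X ⊕ Y ⊆ᶜ S
  ⊕-⊆ᶜ {X} {Y} X⊆S Y⊆S σ p with xor-true (X σ) (Y σ) p
  ... | inj₁ q = X⊆S σ q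
  ... | inj₂ q = Y⊆S σ q

  acyclic-unique : ∀ k {S H F : Chain n} → Acyclic k S → H ⊆ᶜ S → F ⊆ᶜ S → ∂ k H ≈ ∂ k F → H ≈ F
  acyclic-unique k {S} {H} {F} acyc H⊆S F⊆S ∂H≈∂F σ =
    xor-cancel (H σ) (F σ) (acyc (H ⊕ F) (⊕-⊆ᶜ H⊆S F⊆S) ∂[H⊕F]≈∅ σ)
    where
    ∂[H⊕F]≈∅ : ∂ k (H ⊕ F) ≈ ∅ᶜ
    ∂[H⊕F]≈∅ τ = trans (∂-⊕ k H F τ) (trans (cong (_xor ∂ k F τ) (∂H≈∂F τ)) (xor-same (∂ k F τ)))

  acyclic-fill : ∀ k {Z S F : Chain n} → Acyclic k S → F ⊆ᶜ S → ∂ k F ≈ Z → IsFill k Z S F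
  acyclic-fill k acyc F⊆S ∂F≈Z =
    F⊆S , ∂F≈Z , λ H H⊆S ∂H≈Z → acyclic-unique k acyc H⊆S F⊆S (λ τ → trans (∂H≈Z τ) (sym (∂F≈Z τ)))

  ⟪⟫-on : ∀ (σ : Subset n) → ⟪ σ ⟫ σ ≡ true
  ⟪⟫-on σ = dec-true (σ ≟ˢ σ) refl

  ⟪⟫-off : ∀ {σ τ : Subset n} → σ ≢ τ → ⟪ σ ⟫ τ ≡ false
  ⟪⟫-off {σ} {τ} = dec-false (σ ≟ˢ τ)

  _+ᶜ_ : Chain n → Subset n → Chain n
  (T +ᶜ σ) τ = T τ ∨ ⟪ σ ⟫ τ

  +ᶜ-off : ∀ T {σ τ : Subset n} → σ ≢ τ → (T +ᶜ σ) τ ≡ T τ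
  +ᶜ-off T {σ} {τ} σ≢τ = trans (cong (T τ ∨_) (⟪⟫-off σ≢τ)) (∨-identityʳ (T τ))

  drop-∉ : ∀ {T Y : Chain n} {σ} → Y ⊆ᶜ T +ᶜ σ → Y σ ≡ false → Y ⊆ᶜ T
  drop-∉ {T} {Y} {σ} Y⊆ Yσ τ p with σ ≟ˢ τ
  ... | yes refl = ⊥-elim (true≢false (trans (sym p) Yσ))
  ... | no σ≢τ   = trans (sym (+ᶜ-off T σ≢τ)) (Y⊆ τ p)

  drop-∈ : ∀ {T Y : Chain n} {σ} → Y ⊆ᶜ T +ᶜ σ → Y σ ≡ true → Y ⊕ ⟪ σ ⟫ ⊆ᶜ T
  drop-∈ {T} {Y} {σ} Y⊆ Yσ τ p with σ ≟ˢ τ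
  ... | yes refl = ⊥-elim (true≢false (trans (sym p) (trans (xor-comm (Y σ) true) (cong not Yσ))))
  ... | no σ≢τ   = trans (sym (+ᶜ-off T σ≢τ))
                     (Y⊆ τ (trans (sym (xor-identityʳ (Y τ))) p))

  CycleThrough : ℕ → Chain n → Subset n → Chain n → Set
  CycleThrough k T σ Y = Y ⊆ᶜ T +ᶜ σ × ∂ k Y ≈ ∅ᶜ × Y σ ≡ true

  cycleThrough? : ∀ k T σ → Dec (Σ (Chain n) (CycleThrough k T σ))
  cycleThrough? k T σ = search (CycleThrough k T σ) respects
    (λ Y → (Y ⊆ᶜ? (T +ᶜ σ)) ×-dec ((∂ k Y ≈? ∅ᶜ) ×-dec (Y σ Bool.≟ true)))
    where
    respects : Respects≈ (CycleThrough k T σ)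
    respects {Y} {Y′} Y≈Y′ (Y⊆ , ∂Y≈∅ , Yσ) =
      (λ τ p → Y⊆ τ (trans (Y≈Y′ τ) p)) , (λ τ → trans (sym (∂-cong k Y≈Y′ τ)) (∂Y≈∅ τ)) , trans (sym (Y≈Y′ σ)) Yσ

  -- If σ ∉ T, then T +ᶜ σ is not a forest by
  -- maximality of T; since T is one, T +ᶜ σ contains a cycle through σ, and
  -- that cycle with σ removed is the required subset.
  simplex-boundary : ∀ k V (T : Chain n) → IsHypertree k V T → ∀ σ → ∣ σ ∣ ≡ suc k → σ ⊆ V →
                     Σ[ H ∈ Chain n ] (H ⊆ᶜ T × ∂ k H ≈ ∂ k ⟪ σ ⟫)
  simplex-boundary k V T ((onV , acyc) , maximal) σ ∣σ∣ σ⊆V with T σ in σ∈T | cycleThrough? k T σ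
  ... | true  | _ = ⟪ σ ⟫ , (λ τ σ≡τ → subst (λ ρ → T ρ ≡ true) (does-true (σ ≟ˢ τ) σ≡τ) σ∈T) , (λ _ → refl)
  ... | false | yes (Y , Y⊆ , ∂Y≈∅ , Yσ) =
    Y ⊕ ⟪ σ ⟫ , drop-∈ Y⊆ Yσ , λ τ → trans (∂-⊕ k Y ⟪ σ ⟫ τ) (cong (_xor ∂ k ⟪ σ ⟫ τ) (∂Y≈∅ τ))
  ... | false | no none =
    ⊥-elim (true≢false (trans (sym (maximal (T +ᶜ σ) (onV′ , acyc′) (λ τ p → cong (_∨ ⟪ σ ⟫ τ) p) σ σ∈T+σ)) σ∈T))
    where
    σ∈T+σ : (T +ᶜ σ) σ ≡ true
    σ∈T+σ = trans (cong (T σ ∨_) (⟪⟫-on σ)) (∨-zeroʳ (T σ))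
    onV′ : IsChainOn k V (T +ᶜ σ)
    onV′ τ p with σ ≟ˢ τ
    ... | yes refl = ∣σ∣ , σ⊆V
    ... | no _     = onV τ (trans (sym (∨-identityʳ (T τ))) p)
    acyc′ : Acyclic k (T +ᶜ σ)
    acyc′ Y Y⊆ ∂Y≈∅ with Y σ in Yσ
    ... | true  = ⊥-elim (none (Y , Y⊆ , ∂Y≈∅ , Yσ))
    ... | false = acyc Y (drop-∉ Y⊆ Yσ) ∂Y≈∅

  _↾_ : Chain n → List (Subset n) → Chain n
  (W ↾ L) τ = parity (map (λ σ → W σ ∧ ⟪ σ ⟫ τ) L)

  ↾-subsets : ∀ (W : Chain n) → W ↾ subsets n ≈ W
  ↾-subsets W τ =
    trans (parity-subsets (λ σ → W σ ∧ ⟪ σ ⟫ τ)) (trans (⨁-cong (λ σ → ∧-comm (W σ) (⟪ σ ⟫ τ))) (⨁-point τ W))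

  boundary-in-tree : ∀ k V (T W : Chain n) → IsHypertree k V T → IsChainOn k V W → ∀ L →
                     Σ[ H ∈ Chain n ] (H ⊆ᶜ T × ∂ k H ≈ ∂ k (W ↾ L))
  boundary-in-tree k V T W hT onV [] = ∅ᶜ , (λ _ ()) , (λ _ → refl)
  boundary-in-tree k V T W hT onV (σ ∷ L) with boundary-in-tree k V T W hT onV L | W σ in Wσ
  ... | H , H⊆T , ∂H | false = H , H⊆T , ∂H
  ... | H , H⊆T , ∂H | true with simplex-boundary k V T hT σ (proj₁ (onV σ Wσ)) (proj₂ (onV σ Wσ))
  ...   | H′ , H′⊆T , ∂H′ = H′ ⊕ H , ⊕-⊆ᶜ H′⊆T H⊆T , λ τ → begin
    ∂ k (H′ ⊕ H) τ                   ≡⟨ ∂-⊕ k H′ H τ ⟩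
    ∂ k H′ τ xor ∂ k H τ             ≡⟨ cong₂ _xor_ (∂H′ τ) (∂H τ) ⟩
    ∂ k ⟪ σ ⟫ τ xor ∂ k (W ↾ L) τ    ≡⟨ sym (∂-⊕ k ⟪ σ ⟫ (W ↾ L) τ) ⟩
    ∂ k (⟪ σ ⟫ ⊕ (W ↾ L)) τ          ∎
    where open ≡-Reasoning

  fill-exists : ∀ k V (T W Z : Chain n) → IsHypertree k V T → IsChainOn k V W → ∂ k W ≈ Z →
                Σ[ F ∈ Chain n ] IsFill k Z T F
  fill-exists k V T W Z hT onV ∂W≈Z with boundary-in-tree k V T W hT onV (subsets n)
  ... | F , F⊆T , ∂F = F , acyclic-fill k (proj₂ (proj₁ hT)) F⊆T
                             (λ τ → trans (∂F τ) (trans (∂-cong k (↾-subsets W) τ) (∂W≈Z τ)))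

module _ {n : ℕ} (N : Fin n) where

  onV⇒ : ∀ k (X : Chain n) → IsChainOn k (⊤ - N) X → Sized (suc k) X × Avoids N X
  onV⇒ k X onV = (λ σ p → proj₁ (onV σ p)) , λ σ p →
    not-injective (trans (sym (⊆ᵇ-all-but N σ)) (dec-true (σ ⊆? ⊤ - N) (proj₂ (onV σ p))))

  ⇒onV : ∀ k (X : Chain n) → Sized (suc k) X → Avoids N X → IsChainOn k (⊤ - N) X
  ⇒onV k X sz av σ p =
    sz σ p , does-true (σ ⊆? ⊤ - N) (trans (⊆ᵇ-all-but N σ) (cong not (av σ p)))

  -- A k-cycle on V is the boundary of a chain on V: the cone over it from any
  -- other vertex v (here we use that V has at least one vertex).
  cycle-on-V-bounds : ∀ k v (X : Chain n) → v ≢ N → Sized (suc k) X → Avoids N X → ∂ k X ≈ ∅ᶜ →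
                      IsChainOn (suc k) (⊤ - N) (Cone v (Del v X)) × ∂ (suc k) (Cone v (Del v X)) ≈ X
  cycle-on-V-bounds k v X v≢N sz av cyc =
    ⇒onV (suc k) (Cone v (Del v X)) (Cone-sized (suc k) v (Del v X) (Del-sized (suc k) v X sz))
      (Cone-avoids-other N v (Del v X) (λ N≡v → v≢N (sym N≡v)) (Del-avoids-other N v X av)) ,
    cone-filling k v X sz cyc

  link-bounds : ∀ k v (Z : Chain n) → v ≢ N → Sized (suc k) Z → ∂ k Z ≈ ∅ᶜ →
                Σ[ W ∈ Chain n ] (IsChainOn k (⊤ - N) W × ∂ k W ≈ Link N Z)
  link-bounds zero v Z v≢N sz cyc =
    Cone v L ,
    ⇒onV 0 (Cone v L) (Cone-sized 0 v L (Link-sized 0 N Z sz))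
      (Cone-avoids-other N v L (λ N≡v → v≢N (sym N≡v)) (Link-avoids N Z)) ,
    ∂-Cone-zero v L (λ σ p → ∈ᵇ-empty v σ (Link-sized 0 N Z sz σ p)) (Link-sized 0 N Z sz)
    where
    L : Chain n
    L = Link N Z
  link-bounds (suc j) v Z v≢N sz cyc =
    Cone v (Del v L) ,
    cycle-on-V-bounds j v L v≢N (Link-sized (suc j) N Z sz) (Link-avoids N Z) (∂-Link j N Z sz cyc)
    where
    L : Chain n
    L = Link N Z

  -- Z′ = Z ⊕ Cone N (Link N Z) ⊕ F, for F on V with ∂F = Link N Z, is a cycle on V:
  -- Z ⊕ Cone N (Link N Z) is the deletion of N from Z, and the link cancels in ∂Z′.
  shifted-cycle : ∀ k (Z F : Chain n) → Sized (suc k) Z → ∂ k Z ≈ ∅ᶜ →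
                  Sized (suc k) F → Avoids N F → ∂ k F ≈ Link N Z →
                  let Z′ = Z ⊕ Cone N (Link N Z) ⊕ F in Sized (suc k) Z′ × Avoids N Z′ × ∂ k Z′ ≈ ∅ᶜ
  shifted-cycle k Z F szZ cycZ szF avF ∂F≈L =
    (λ σ p → ⊕-sized (suc k) (Del-sized (suc k) N Z szZ) szF σ (trans (sym (Z′≈ σ)) p)) ,
    (λ σ p → ⊕-avoids N (Del-avoids N Z) avF σ (trans (sym (Z′≈ σ)) p)) ,
    λ τ → begin
      ∂ k (Z ⊕ Cone N L ⊕ F) τ                           ≡⟨ ∂-⊕ k (Z ⊕ Cone N L) F τ ⟩
      ∂ k (Z ⊕ Cone N L) τ xor ∂ k F τ                   ≡⟨ cong (_xor ∂ k F τ) (∂-⊕ k Z (Cone N L) τ) ⟩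
      (∂ k Z τ xor ∂ k (Cone N L) τ) xor ∂ k F τ         ≡⟨ cong₂ (λ a b → (a xor b) xor ∂ k F τ) (cycZ τ) (∂-Cone-Link k N Z szZ cycZ τ) ⟩
      L τ xor ∂ k F τ                                    ≡⟨ cong (L τ xor_) (∂F≈L τ) ⟩
      L τ xor L τ                                        ≡⟨ xor-same (L τ) ⟩
      false                                              ∎
    where
    open ≡-Reasoning
    L : Chain n
    L = Link N Z
    Z′≈ : ∀ σ → (Z ⊕ Cone N L ⊕ F) σ ≡ (Del N Z ⊕ F) σ
    Z′≈ σ = cong (_xor F σ) (xor-move (Z σ) (Del N Z σ) (Cone N L σ) (Del-Link N Z σ))

  coned-on : ∀ (T T′ : Chain n) σ → Avoids N T → N ∈ᵇ σ ≡ true → (T ⊕ Cone N T′) σ ≡ T′ (σ - N)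
  coned-on T T′ σ avT N∈σ rewrite avoids-off N σ avT N∈σ | N∈σ = refl

  coned-off : ∀ (T T′ : Chain n) σ → N ∈ᵇ σ ≡ false → (T ⊕ Cone N T′) σ ≡ T σ
  coned-off T T′ σ N∉σ rewrite N∉σ = xor-identityʳ (T σ)

  -- T ⊕ Cone N T′ is acyclic when T and T′ are: the link at N of a cycle D
  -- inside it is a cycle inside T′, hence empty, so D lies inside T.
  coned-acyclic : ∀ k (T T′ : Chain n) → Sized (suc (suc k)) T → Avoids N T → Acyclic (suc k) T →
                  Sized (suc k) T′ → Acyclic k T′ → Acyclic (suc k) (T ⊕ Cone N T′)
  coned-acyclic k T T′ szT avT acycT szT′ acycT′ D D⊆S ∂D≈∅ = acycT D D⊆T ∂D≈∅
    where
    link-empty : Link N D ≈ ∅ᶜ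
    link-empty = acycT′ (Link N D) LD⊆T′ (∂-Link k N D szD ∂D≈∅)
      where
      szD : Sized (suc (suc k)) D
      szD σ p = ⊕-sized (suc (suc k)) szT (Cone-sized (suc k) N T′ szT′) σ (D⊆S σ p)
      LD⊆T′ : Link N D ⊆ᶜ T′
      LD⊆T′ τ p with N ∈ᵇ τ in N∈τ
      ... | false = begin
        T′ τ                         ≡⟨ cong T′ (sym (delete-insert N τ N∈τ)) ⟩
        T′ ((⁅ N ⁆ ∪ τ) - N)         ≡⟨ sym (coned-on T T′ (⁅ N ⁆ ∪ τ) avT (∈ᵇ-insert N τ)) ⟩
        (T ⊕ Cone N T′) (⁅ N ⁆ ∪ τ)   ≡⟨ D⊆S (⁅ N ⁆ ∪ τ) p ⟩
        true                         ∎
        where open ≡-Reasoning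
    D⊆T : D ⊆ᶜ T
    D⊆T σ p with N ∈ᵇ σ in N∈σ
    ... | false = trans (sym (coned-off T T′ σ N∈σ)) (D⊆S σ p)
    ... | true  = ⊥-elim (true≢false (begin
      true                            ≡⟨ sym p ⟩
      D σ                             ≡⟨ cong D (sym (insert-delete N σ N∈σ)) ⟩
      D (⁅ N ⁆ ∪ (σ - N))             ≡⟨ cong (_∧ D (⁅ N ⁆ ∪ (σ - N))) (sym (cong not (∈ᵇ-delete N σ))) ⟩
      Link N D (σ - N)                ≡⟨ link-empty (σ - N) ⟩
      false                           ∎))
      where open ≡-Reasoning

  coned-fill-⊆ : ∀ (T T′ F G : Chain n) → Avoids N T → F ⊆ᶜ T′ → G ⊆ᶜ T → Cone N F ⊕ G ⊆ᶜ T ⊕ Cone N T′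
  coned-fill-⊆ T T′ F G avT F⊆T′ G⊆T σ p = by-apex (true-or-false (N ∈ᵇ σ))
    where
    avG : Avoids N G
    avG σ q = avT σ (G⊆T σ q)
    p′ : (G ⊕ Cone N F) σ ≡ true
    p′ = trans (xor-comm (G σ) (Cone N F σ)) p
    by-apex : N ∈ᵇ σ ≡ true ⊎ N ∈ᵇ σ ≡ false → (T ⊕ Cone N T′) σ ≡ true
    by-apex (inj₁ N∈σ) = trans (coned-on T T′ σ avT N∈σ) (F⊆T′ (σ - N) (trans (sym (coned-on G F σ avG N∈σ)) p′))
    by-apex (inj₂ N∉σ) = trans (coned-off T T′ σ N∉σ) (G⊆T σ (trans (sym (coned-off G F σ N∉σ)) p′))

  -- ... and its boundary is Z when ∂F = Link N Z and ∂G = Z ⊕ Cone N (Link N Z) ⊕ F: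
  -- ∂(Cone N F) = F ⊕ Cone N (Link N Z), and F and the cone over the link cancel.
  coned-fill-∂ : ∀ k (Z F G : Chain n) → Sized (suc k) F → Avoids N F → ∂ k F ≈ Link N Z →
                 ∂ (suc k) G ≈ Z ⊕ Cone N (Link N Z) ⊕ F → ∂ (suc k) (Cone N F ⊕ G) ≈ Z
  coned-fill-∂ k Z F G szF avF ∂F≈L ∂G≈Z′ τ = begin
    ∂ (suc k) (Cone N F ⊕ G) τ                               ≡⟨ ∂-⊕ (suc k) (Cone N F) G τ ⟩
    ∂ (suc k) (Cone N F) τ xor ∂ (suc k) G τ                 ≡⟨ cong₂ _xor_ (∂-Cone-suc k N F avF szF τ) (∂G≈Z′ τ) ⟩
    (F τ xor Cone N (∂ k F) τ) xor ((Z τ xor Cone N L τ) xor F τ)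
      ≡⟨ cong (λ c → (F τ xor c) xor ((Z τ xor Cone N L τ) xor F τ)) (guarded (N ∈ᵇ τ) (λ _ → ∂F≈L (τ - N))) ⟩
    (F τ xor Cone N L τ) xor ((Z τ xor Cone N L τ) xor F τ)  ≡⟨ xor-cancel-pairs (F τ) (Cone N L τ) (Z τ) ⟩
    Z τ                                                      ∎
    where
    open ≡-Reasoning
    L : Chain n
    L = Link N Z

  coned-fill-formula : ∀ k v (T T′ Z : Chain n) → v ≢ N →
    IsHypertree (suc k) (⊤ - N) T → IsHypertree k (⊤ - N) T′ → Sized (suc k) Z → ∂ k Z ≈ ∅ᶜ →
    Σ[ F ∈ Chain n ] (IsFill k (Link N Z) T′ F
      × Σ[ G ∈ Chain n ] (IsFill (suc k) (Z ⊕ Cone N (Link N Z) ⊕ F) T G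
        × IsFill (suc k) Z (T ⊕ Cone N T′) (Cone N F ⊕ G)))
  coned-fill-formula k v T T′ Z v≢N hT@((onT , acycT) , _) hT′@((onT′ , acycT′) , _) szZ ∂Z≈∅ =
    let szT , avT = onV⇒ (suc k) T onT
        szT′ , avT′ = onV⇒ k T′ onT′
        W , W-on , ∂W≈L = link-bounds k v Z v≢N szZ ∂Z≈∅
        F , F-fill = fill-exists k (⊤ - N) T′ W (Link N Z) hT′ W-on ∂W≈L
        F⊆T′ , ∂F≈L , _ = F-fill
        Z′ = Z ⊕ Cone N (Link N Z) ⊕ F
        szZ′ , avZ′ , ∂Z′≈∅ = shifted-cycle k Z F szZ ∂Z≈∅ (λ σ p → szT′ σ (F⊆T′ σ p)) (λ σ p → avT′ σ (F⊆T′ σ p)) ∂F≈L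
        W′-on , ∂W′≈Z′ = cycle-on-V-bounds k v Z′ v≢N szZ′ avZ′ ∂Z′≈∅
        G , G-fill = fill-exists (suc k) (⊤ - N) T (Cone v (Del v Z′)) Z′ hT W′-on ∂W′≈Z′
        G⊆T , ∂G≈Z′ , _ = G-fill
    in F , F-fill , G , G-fill ,
       acyclic-fill (suc k) (coned-acyclic k T T′ szT avT acycT szT′ acycT′)
         (coned-fill-⊆ T T′ F G avT F⊆T′ G⊆T)
         (coned-fill-∂ k Z F G (λ σ p → szT′ σ (F⊆T′ σ p)) (λ σ p → avT′ σ (F⊆T′ σ p)) ∂F≈L ∂G≈Z′)

-- The theorem: vertex n is lastV m, [n-1] = initV m = ⊤ - lastV m, and the
-- second vertex required by the cone constructions is vertex 0 (as n ≥ 2).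
claim1 : (e m : ℕ) → 1 ≤ m → (T T' Z : Chain (suc m))
       → IsHypertree (suc e) (initV m) T
       → IsHypertree e (initV m) T'
       → IsCycle e ⊤ Z
       → Σ[ F ∈ Chain (suc m) ] (IsFill e (Link (lastV m) Z) T' F
           × Σ[ G ∈ Chain (suc m) ] (IsFill (suc e) (Z ⊕ Cone (lastV m) (Link (lastV m) Z) ⊕ F) T G
             × IsFill (suc e) Z (T ⊕ Cone (lastV m) T') (Cone (lastV m) F ⊕ G)))
claim1 e (suc m) _ T T′ Z hT hT′ (onZ , ∂Z≈∅) =
  coned-fill-formula (lastV (suc m)) e zero T T′ Z (λ ()) hT hT′ (λ σ p → proj₁ (onZ σ p)) ∂Z≈∅
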